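{- For every positive integer $n\notin\{1,2,3,4,6\}$ we have $g(n)\leq \frac{2}{5}n$.
   Context: $g(n)$ denotes Jacobsthal's function: the maximal difference between consecutive integers that are coprime to $n$. -}

module Defs where

open import Data.Nat using (ℕ; _+_; _*_; _≤_; _<_)
open import Data.Nat.Coprimality using (Coprime)
open import Data.Product using (_×_; ∃)
open import Relation.Nullary using (¬_)

-- Coprimality to n is n-periodic, so considering a ∈ ℕ loses no generality.
ConsecutiveCoprimeGap : ℕ → ℕ → ℕ → Set
ConsecutiveCoprimeGap n a d =
  (1 ≤ d) × Coprime a n × Coprime (a + d) n ×
  (∀ k → 0 < k → k < d → ¬ Coprime (a + k) n)

IsJacobsthal : ℕ → ℕ → Set
IsJacobsthal n m =
  (∃ λ a → ConsecutiveCoprimeGap n a m) ×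
  (∀ a d → ConsecutiveCoprimeGap n a d → d ≤ m)

-- Since coprimality to n is n-periodic, it suffices to exhibit integers
-- 0 = p₀ < p₁ < … < p_k with p_k ≥ n and p₁, …, p_k coprime to n, whose
-- consecutive differences are at most 2n/5: every window of that length
-- starting in [0, n) then contains an integer coprime to n. Such chains are
-- given uniformly along the residue classes of n modulo 8 (modulo 4 for odd
-- n); each point p is certified coprime to n by an identity u p − v n = ± c
-- with c = 1, or with c a power of 2 and p odd.
module Submission where

open import Defs
open import Data.Nat using (ℕ; _*_; _≤_; _<_)
open import Relation.Binary.PropositionalEquality using (_≢_)

open import Data.Nat using (zero; suc; _+_; _∸_; _^_; NonZero; _≤?_; z≤n)
open import Data.Nat.Properties
open import Data.Nat.Divisibility using (_∣_; ∣m+n∣m⇒∣n; ∣m⇒∣m*n; ∣n⇒∣m*n)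
open import Data.Nat.DivMod using (_%_; _/_; m%n<n; m≡m%n+[m/n]*n)
open import Data.Nat.Coprimality using (Coprime; 1-coprimeTo; coprime-factors)
  renaming (sym to coprime-sym)
open import Data.Nat.Tactic.RingSolver using (solve; solve-∀)
open import Data.List using ([]; _∷_)
open import Data.Product using (∃; _×_; _,_)
open import Data.Sum using (_⊎_; inj₁; inj₂)
open import Relation.Nullary using (¬_; yes; no; contradiction)
open import Relation.Binary.PropositionalEquality using (_≡_; refl; sym; subst; trans; cong)

coprime-* : ∀ {m n o} → Coprime m n → Coprime m o → Coprime m (n * o)
coprime-* {o = o} m⊥n m⊥o (d∣m , d∣n*o) =
  m⊥o (d∣m , coprime-factors (coprime-sym m⊥n) (d∣n*o , ∣m⇒∣m*n o d∣m))

coprime-^ : ∀ {m n} k → Coprime m n → Coprime m (n ^ k)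
coprime-^ {m} zero    m⊥n = coprime-sym (1-coprimeTo m)
coprime-^     (suc k) m⊥n = coprime-* m⊥n (coprime-^ k m⊥n)

coprime-combination : ∀ {x n c} u v → Coprime x c →
  u * x ≡ v * n + c ⊎ v * n ≡ u * x + c → Coprime x n
coprime-combination {x} {n} {c} u v x⊥c combination {d} (d∣x , d∣n) =
  x⊥c (d∣x , d∣c combination)
  where
  d∣c : u * x ≡ v * n + c ⊎ v * n ≡ u * x + c → d ∣ c
  d∣c (inj₁ eq) = ∣m+n∣m⇒∣n (subst (d ∣_) eq (∣n⇒∣m*n u d∣x)) (∣n⇒∣m*n v d∣n)
  d∣c (inj₂ eq) = ∣m+n∣m⇒∣n (subst (d ∣_) eq (∣n⇒∣m*n v d∣n)) (∣n⇒∣m*n u d∣x)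

odd⇒coprime-2^ : ∀ {x} m k → x ≡ m * 2 + 1 → Coprime x (2 ^ k)
odd⇒coprime-2^ {x} m k x≡2m+1 =
  coprime-^ k (coprime-combination 1 m (coprime-sym (1-coprimeTo x))
                                     (inj₁ (trans (*-identityˡ x) x≡2m+1)))

coprime-shift : ∀ {x y n} q → x ≡ q * n + y → Coprime y n → Coprime x n
coprime-shift q x≡qn+y y⊥n (d∣x , d∣n) =
  y⊥n (∣m+n∣m⇒∣n (subst (_ ∣_) x≡qn+y d∣x) (∣n⇒∣m*n q d∣n) , d∣n)

m+k≡n⇒m≤n : ∀ {m n} k → m + k ≡ n → m ≤ n
m+k≡n⇒m≤n {m} k refl = m≤m+n m k

-- Jumps carry their slack k = x + G − y, so that each one is checked by ring
-- normalisation.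
data Chain (P : ℕ → Set) (G : ℕ) : ℕ → ℕ → Set where
  done : ∀ {x z} → z ≤ x → Chain P G x z
  jump : ∀ {x z} y k → y + k ≡ x + G → P y → Chain P G y z → Chain P G x z

chain-window : ∀ {P G x z r} → Chain P G x z → x ≤ r → r < z →
  ∃ λ t → 1 ≤ t × t ≤ G × P (r + t)
chain-window (done z≤x) x≤r r<z = contradiction (≤-trans z≤x x≤r) (<⇒≱ r<z)
chain-window {P} {G} {r = r} (jump {x} y k y+k≡x+G py rest) x≤r r<z with y ≤? r
... | yes y≤r = chain-window rest y≤r r<z
... | no  y≰r = y ∸ r , m<n⇒0<n∸m r<y , y∸r≤G , subst P (sym (m+[n∸m]≡n (<⇒≤ r<y))) py
  where
  r<y = ≰⇒> y≰r
  y∸r≤G : y ∸ r ≤ G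
  y∸r≤G = m≤n+o⇒m∸n≤o y r (≤-trans (m+k≡n⇒m≤n k y+k≡x+G) (+-monoˡ-≤ G x≤r))

data CoprimeCertificate (n x : ℕ) : Set where
  unit-combination : ∀ u v → u * x ≡ v * n + 1 ⊎ v * n ≡ u * x + 1 → CoprimeCertificate n x
  odd-combination  : ∀ m k u v → x ≡ m * 2 + 1 →
    u * x ≡ v * n + 2 ^ k ⊎ v * n ≡ u * x + 2 ^ k → CoprimeCertificate n x

certificate⇒coprime : ∀ {n x} → CoprimeCertificate n x → Coprime x n
certificate⇒coprime {x = x} (unit-combination u v combination) =
  coprime-combination u v (coprime-sym (1-coprimeTo x)) combination
certificate⇒coprime (odd-combination m k u v x≡2m+1 combination) =
  coprime-combination u v (odd⇒coprime-2^ m k x≡2m+1) combination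

CoprimeChain : ℕ → ℕ → Set
CoprimeChain n G = Chain (CoprimeCertificate n) G 0 n

gap≤jump : ∀ {n G a d} .{{_ : NonZero n}} → CoprimeChain n G →
  ConsecutiveCoprimeGap n a d → d ≤ G
gap≤jump {n} {a = a} {d} chain (_ , _ , _ , inside) with chain-window chain z≤n (m%n<n a n)
... | t , 1≤t , t≤G , r+t⊥n = ≤-trans (≮⇒≥ t≮d) t≤G
  where
  a+t≡qn+r+t : a + t ≡ a / n * n + (a % n + t)
  a+t≡qn+r+t = trans (cong (_+ t) (m≡m%n+[m/n]*n a n)) (rearrange (a % n) (a / n * n) t)
    where
    rearrange : ∀ r k t → (r + k) + t ≡ k + (r + t)
    rearrange = solve-∀
  t≮d : ¬ t < d
  t≮d t<d = inside t 1≤t t<d (coprime-shift (a / n) a+t≡qn+r+t (certificate⇒coprime r+t⊥n))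

record ShortChain (n : ℕ) : Set where
  constructor shortChain
  field
    G      : ℕ
    5G≤2n  : 5 * G ≤ 2 * n
    chain  : CoprimeChain n G

module _ (i : ℕ) where
  private
    vs = i ∷ []

  short-chain-4i+5 : ShortChain (4 * i + 5)
  short-chain-4i+5 = shortChain (i + 2) (m+k≡n⇒m≤n (3 * i) (solve vs))
    (jump 1 (i + 1) (solve vs) (unit-combination 1 0 (inj₁ refl))
    (jump (i + 1) 2 (solve vs) (unit-combination 4 1 (inj₂ (solve vs)))
    (jump (2 * i + 2) 1 (solve vs) (unit-combination 2 1 (inj₂ (solve vs)))
    (jump (2 * i + 3) (i + 1) (solve vs) (unit-combination 2 1 (inj₁ (solve vs)))
    (jump (3 * i + 4) 1 (solve vs) (unit-combination 4 3 (inj₁ (solve vs)))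
    (jump (4 * i + 4) 2 (solve vs) (unit-combination 1 1 (inj₂ (solve vs)))
    (jump (4 * i + 6) i (solve vs) (unit-combination 1 1 (inj₁ (solve vs)))
    (done (m+k≡n⇒m≤n 1 (solve vs))))))))))

  short-chain-4i+7 : ShortChain (4 * i + 7)
  short-chain-4i+7 = shortChain (i + 2) (m+k≡n⇒m≤n (3 * i + 4) (solve vs))
    (jump 1 (i + 1) (solve vs) (unit-combination 1 0 (inj₁ refl))
    (jump (i + 2) 1 (solve vs) (unit-combination 4 1 (inj₁ (solve vs)))
    (jump (2 * i + 3) 1 (solve vs) (unit-combination 2 1 (inj₂ (solve vs)))
    (jump (2 * i + 4) (i + 1) (solve vs) (unit-combination 2 1 (inj₁ (solve vs)))
    (jump (3 * i + 5) 1 (solve vs) (unit-combination 4 3 (inj₂ (solve vs)))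
    (jump (4 * i + 6) 1 (solve vs) (unit-combination 1 1 (inj₂ (solve vs)))
    (jump (4 * i + 8) i (solve vs) (unit-combination 1 1 (inj₁ (solve vs)))
    (done (m+k≡n⇒m≤n 1 (solve vs))))))))))

  short-chain-8i+8 : ShortChain (8 * i + 8)
  short-chain-8i+8 = shortChain (2 * i + 2) (m+k≡n⇒m≤n (6 * i + 6) (solve vs))
    (jump 1 (2 * i + 1) (solve vs) (unit-combination 1 0 (inj₁ refl))
    (jump (2 * i + 3) 0 (solve vs) (odd-combination (i + 1) 2 4 1 (solve vs) (inj₁ (solve vs)))
    (jump (4 * i + 5) 0 (solve vs) (odd-combination (2 * i + 2) 1 2 1 (solve vs) (inj₁ (solve vs)))
    (jump (6 * i + 7) 0 (solve vs) (odd-combination (3 * i + 3) 2 4 3 (solve vs) (inj₁ (solve vs)))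
    (jump (8 * i + 9) 0 (solve vs) (unit-combination 1 1 (inj₁ (solve vs)))
    (done (m+k≡n⇒m≤n 1 (solve vs))))))))

  short-chain-8i+10 : ShortChain (8 * i + 10)
  short-chain-8i+10 = shortChain (2 * i + 4) (m+k≡n⇒m≤n (6 * i) (solve vs))
    (jump 1 (2 * i + 3) (solve vs) (unit-combination 1 0 (inj₁ refl))
    (jump (2 * i + 3) 2 (solve vs) (odd-combination (i + 1) 1 4 1 (solve vs) (inj₁ (solve vs)))
    (jump (4 * i + 7) 0 (solve vs) (odd-combination (2 * i + 3) 2 2 1 (solve vs) (inj₁ (solve vs)))
    (jump (6 * i + 7) 4 (solve vs) (odd-combination (3 * i + 3) 1 4 3 (solve vs) (inj₂ (solve vs)))
    (jump (8 * i + 9) 2 (solve vs) (unit-combination 1 1 (inj₂ (solve vs)))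
    (jump (8 * i + 11) (2 * i + 2) (solve vs) (unit-combination 1 1 (inj₁ (solve vs)))
    (done (m+k≡n⇒m≤n 1 (solve vs)))))))))

  short-chain-8i+12 : ShortChain (8 * i + 12)
  short-chain-8i+12 = shortChain (2 * i + 4) (m+k≡n⇒m≤n (6 * i + 4) (solve vs))
    (jump 1 (2 * i + 3) (solve vs) (unit-combination 1 0 (inj₁ refl))
    (jump (2 * i + 5) 0 (solve vs) (odd-combination (i + 2) 3 4 1 (solve vs) (inj₁ (solve vs)))
    (jump (4 * i + 7) 2 (solve vs) (odd-combination (2 * i + 3) 1 2 1 (solve vs) (inj₁ (solve vs)))
    (jump (6 * i + 11) 0 (solve vs) (odd-combination (3 * i + 5) 3 4 3 (solve vs) (inj₁ (solve vs)))
    (jump (8 * i + 13) 2 (solve vs) (unit-combination 1 1 (inj₁ (solve vs)))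
    (done (m+k≡n⇒m≤n 1 (solve vs))))))))

  short-chain-8i+14 : ShortChain (8 * i + 14)
  short-chain-8i+14 = shortChain (2 * i + 4) (m+k≡n⇒m≤n (6 * i + 8) (solve vs))
    (jump 1 (2 * i + 3) (solve vs) (unit-combination 1 0 (inj₁ refl))
    (jump (2 * i + 3) 2 (solve vs) (odd-combination (i + 1) 1 4 1 (solve vs) (inj₂ (solve vs)))
    (jump (4 * i + 5) 2 (solve vs) (odd-combination (2 * i + 2) 2 2 1 (solve vs) (inj₂ (solve vs)))
    (jump (4 * i + 9) (2 * i) (solve vs) (odd-combination (2 * i + 4) 2 2 1 (solve vs) (inj₁ (solve vs)))
    (jump (6 * i + 11) 2 (solve vs) (odd-combination (3 * i + 5) 1 4 3 (solve vs) (inj₁ (solve vs)))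
    (jump (8 * i + 13) 2 (solve vs) (unit-combination 1 1 (inj₂ (solve vs)))
    (jump (8 * i + 15) (2 * i + 2) (solve vs) (unit-combination 1 1 (inj₁ (solve vs)))
    (done (m+k≡n⇒m≤n 1 (solve vs))))))))))

ShortChain-≡ : ∀ {m n} → ShortChain m → m ≡ n → ShortChain n
ShortChain-≡ chain refl = chain

short-chain : ∀ {n} r q → n ≡ r + q * 8 → r < 8 →
  0 < n → n ≢ 1 → n ≢ 2 → n ≢ 3 → n ≢ 4 → n ≢ 6 → ShortChain n
short-chain 0 zero    refl _ () _ _ _ _ _
short-chain 0 (suc q) refl _ _ _ _ _ _ _ = ShortChain-≡ (short-chain-8i+8 q) (solve (q ∷ []))
short-chain 1 zero    refl _ _ n≢1 _ _ _ _ = contradiction refl n≢1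
short-chain 1 (suc q) refl _ _ _ _ _ _ _ = ShortChain-≡ (short-chain-4i+5 (2 * q + 1)) (solve (q ∷ []))
short-chain 2 zero    refl _ _ _ n≢2 _ _ _ = contradiction refl n≢2
short-chain 2 (suc q) refl _ _ _ _ _ _ _ = ShortChain-≡ (short-chain-8i+10 q) (solve (q ∷ []))
short-chain 3 zero    refl _ _ _ _ n≢3 _ _ = contradiction refl n≢3
short-chain 3 (suc q) refl _ _ _ _ _ _ _ = ShortChain-≡ (short-chain-4i+7 (2 * q + 1)) (solve (q ∷ []))
short-chain 4 zero    refl _ _ _ _ _ n≢4 _ = contradiction refl n≢4
short-chain 4 (suc q) refl _ _ _ _ _ _ _ = ShortChain-≡ (short-chain-8i+12 q) (solve (q ∷ []))
short-chain 5 q       refl _ _ _ _ _ _ _ = ShortChain-≡ (short-chain-4i+5 (2 * q)) (solve (q ∷ []))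
short-chain 6 zero    refl _ _ _ _ _ _ n≢6 = contradiction refl n≢6
short-chain 6 (suc q) refl _ _ _ _ _ _ _ = ShortChain-≡ (short-chain-8i+14 q) (solve (q ∷ []))
short-chain 7 q       refl _ _ _ _ _ _ _ = ShortChain-≡ (short-chain-4i+7 (2 * q)) (solve (q ∷ []))
short-chain (suc (suc (suc (suc (suc (suc (suc (suc _)))))))) _ _ 8+r<8 _ _ _ _ _ _ =
  contradiction 8+r<8 (m+n≮m 8 _)

lemma3 : ∀ (n m : ℕ) → 0 < n → n ≢ 1 → n ≢ 2 → n ≢ 3 → n ≢ 4 → n ≢ 6 →
    IsJacobsthal n m → 5 * m ≤ 2 * n
lemma3 zero _ () _ _ _ _ _ _
lemma3 n@(suc _) m 0<n n≢1 n≢2 n≢3 n≢4 n≢6 ((_ , gap) , _)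
  with short-chain (n % 8) (n / 8) (m≡m%n+[m/n]*n n 8) (m%n<n n 8) 0<n n≢1 n≢2 n≢3 n≢4 n≢6
... | shortChain _ 5G≤2n chain = ≤-trans (*-monoʳ-≤ 5 (gap≤jump chain gap)) 5G≤2n
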